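{- Let $p\geq 2$ be an integer and let $A=(a_0,a_1,\dots,a_{p-1})$ be a vector of complex numbers with $a_0+a_1+\dots+a_{p-1}=0$. For a positive integer $N$ define \[ F_N(x;A)=\sum_{n=0}^{p^N-1} a_{v_p(n)}x^n, \] where $v_p(n)$ is the sum of the base-$p$ digits of $n$ reduced modulo $p$. Then for every positive integer $N$ there exists a polynomial $P_N(x)$ with complex coefficients, of the form $P_N(x)=\sum_{j\in I_N} c_j x^j$ where $I_N$ is the set of integers $0\le j<p^N$ all of whose $N$ base-$p$ digits lie in $\{0,1,\dots,p-2\}$ and the $c_j$ are complex numbers, such that \[ F_N(x;A)=P_N(x)\prod_{m=0}^{N-1}\left(1-x^{p^m}\right). \]
   Context: $v_p(n)$ is the generalized Prouhet–Thue–Morse sequence: if $n=n_dp^d+\dots+n_1p+n_0$ with $0\le n_j\le p-1$, then $v_p(n)\equiv n_0+n_1+\dots+n_d \pmod p$ with $0\le v_p(n)\le p-1$. In the paper the polynomial $P_N(x;C_N)$ is defined recursively by $P_1(x;C_1)=c_0+c_1x+\dots+c_{p-2}x^{p-2}$ and $P_N(x;C_N)=\sum_{k=0}^{p-2}x^{kp^{N-1}}P_{N-1}(x;C_{N-1}(k))$ with $C_{N-1}(k)=(c_{j+kp^{N-1}}: c_j\in C_{N-1})$; this is exactly a polynomial whose coefficients are supported on the index set $I_N$ described in the claim. -}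

module Defs where

open import Level using (Level)
open import Data.Nat using (ℕ; zero; suc; _+_; _*_; _∸_; _^_; _<_; _<?_; _≟_; NonZero)
open import Data.Nat.DivMod using (_/_; _%_; _mod_)
open import Data.Fin using (Fin)
import Data.Fin as F
open import Relation.Nullary using (yes; no; ¬_)
open import Algebra.Bundles using (CommutativeRing)

-- Sum of the base-p digits of n (full expansion).  The fuel argument is
-- taken to be n itself, which is always enough since n / p < n for n > 0.
digitSumFuel : (p : ℕ) .{{_ : NonZero p}} → ℕ → ℕ → ℕ
digitSumFuel p zero    n = 0
digitSumFuel p (suc f) n = n % p + digitSumFuel p f (n / p)

digitSum : (p : ℕ) .{{_ : NonZero p}} → ℕ → ℕ
digitSum p n = digitSumFuel p n n

v : (p : ℕ) .{{_ : NonZero p}} → ℕ → Fin p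
v p n = digitSum p n mod p

digit : (p : ℕ) .{{_ : NonZero p}} → ℕ → ℕ → ℕ
digit p zero    j = j % p
digit p (suc m) j = digit p m (j / p)

InI : (p : ℕ) .{{_ : NonZero p}} → ℕ → ℕ → Set
InI p N j = (j < p ^ N) Data.Product.× (∀ m → m < N → digit p m j < p ∸ 1)
  where import Data.Product

-- Polynomials over a commutative ring R, represented by their coefficient
-- sequences ℕ → Carrier (all sequences below have finite support).
module Poly {c ℓ : Level} (R : CommutativeRing c ℓ) where
  open CommutativeRing R using (Carrier; 0#; 1#) renaming (_+_ to _+ᴿ_; _*_ to _*ᴿ_; _-_ to _-ᴿ_)

  Ser : Set c
  Ser = ℕ → Carrier

  sumBelow : (ℕ → Carrier) → ℕ → Carrier
  sumBelow f zero    = 0#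
  sumBelow f (suc n) = sumBelow f n +ᴿ f n

  sumFin : {n : ℕ} → (Fin n → Carrier) → Carrier
  sumFin {zero}  a = 0#
  sumFin {suc n} a = a F.zero +ᴿ sumFin (λ i → a (F.suc i))

  _⊛_ : Ser → Ser → Ser
  (f ⊛ g) n = sumBelow (λ k → f k *ᴿ g (n ∸ k)) (suc n)

  mono : ℕ → Ser
  mono k n with n ≟ k
  ... | yes _ = 1#
  ... | no  _ = 0#

  oneMinusX^ : ℕ → Ser
  oneMinusX^ k n = mono 0 n -ᴿ mono k n

  prodFactors : ℕ → ℕ → Ser
  prodFactors p zero    = mono 0
  prodFactors p (suc N) = prodFactors p N ⊛ oneMinusX^ (p ^ N)

  F_N : (p : ℕ) .{{_ : NonZero p}} → (Fin p → Carrier) → ℕ → Ser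
  F_N p A N n with n <? p ^ N
  ... | yes _ = A (v p n)
  ... | no  _ = 0#

{-# OPTIONS --safe #-}
-- Work with an arbitrary coefficient function a of the (unreduced) digit sum whose sums over any p
-- consecutive arguments vanish; for a = A ∘ (_mod p) this is the hypothesis Σ A = 0.  Splitting off
-- the top digit q gives F_{N+1}(a) = Σ_{q<p} x^{q p^N} F_N(a(q + ·)).  With the partial sums
-- S_m = Σ_{k<m} F_N(a(k + ·)), summation by parts and S_p = F_N(Σ_{k<p} a(k + ·)) = 0 turn this into
-- (1 - x^{p^N}) Σ_{q<p-1} x^{q p^N} S_{q+1}.  Each S_{q+1} is F_N of a cumulative sum of translates of a,
-- whose window sums vanish again, so by induction S_{q+1} = c_q ∏_{m<N} (1 - x^{p^m}) with c_q supported
-- on I_N; as q ≤ p - 2, the shifted x^{q p^N} c_q are supported on I_{N+1}.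
module Submission where

open import Defs
open import Level using (Level)
open import Data.Nat using (ℕ; _≤_; NonZero)
open import Data.Fin using (Fin)
open import Data.Product using (Σ; _×_)
open import Relation.Nullary using (¬_)
open import Algebra.Bundles using (CommutativeRing)

open import Data.Nat using (zero; suc; _+_; _*_; _∸_; _^_; _<_; _≟_; _<?_; z≤n; s≤s; _%_; _/_)
import Data.Nat.Properties as ℕ
open import Data.Nat.DivMod
  using ( _mod_; m≡m%n+[m/n]*n; m%n<n; m<n⇒m%n≡m; m<n⇒m/n≡0; m/n≤m; m/n<m; 0/n≡0; m*n/n≡m
        ; [m+n]%n≡m%n; [m+kn]%n≡m%n; +-distrib-/-∣ʳ; m<n*o⇒m/o<n)
open import Data.Nat.Divisibility using (divides-refl)
open import Data.Fin using (toℕ)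
import Data.Fin as Fin
import Data.Fin.Properties as Finₚ
open import Data.Product using (_,_; proj₁; proj₂)
open import Data.Unit using (⊤)
open import Data.Maybe using (nothing)
open import Function using (_∘_; _$_)
open import Relation.Nullary using (yes; no; contradiction)
open import Relation.Binary.PropositionalEquality as ≡ using (_≡_; _≢_)
open import Algebra.Properties.CommutativeSemigroup ℕ.+-commutativeSemigroup using (x∙yz≈y∙xz)
open import Tactic.RingSolver.Core.AlmostCommutativeRing using (fromCommutativeRing)

r+q*P<Q*P : ∀ {r q P Q} → r < P → q < Q → r + q * P < Q * P
r+q*P<Q*P {r} {q} {P} r<P q<Q = ℕ.<-≤-trans (ℕ.+-monoˡ-< (q * P) r<P) (ℕ.*-monoˡ-≤ P q<Q)

[r+q*P]/P≡q : ∀ {r} q P .{{_ : NonZero P}} → r < P → (r + q * P) / P ≡ q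
[r+q*P]/P≡q {r} q P r<P = ≡.trans (+-distrib-/-∣ʳ r (divides-refl q)) (≡.cong₂ _+_ (m<n⇒m/n≡0 r<P) (m*n/n≡m q P))

module Digits (p : ℕ) .{{_ : NonZero p}} (1<p : 1 < p) where

  private
    0<p : 0 < p
    0<p = ℕ.<-trans (s≤s z≤n) 1<p

    /p≤ : ∀ n f → n ≤ suc f → n / p ≤ f
    /p≤ zero    f _ = ℕ.≤-trans (m/n≤m 0 p) z≤n
    /p≤ (suc n) f n≤ = ℕ.≤-pred (ℕ.<-≤-trans (m/n<m (suc n) p 1<p) n≤)

  digitSumFuel-0 : ∀ f → digitSumFuel p f 0 ≡ 0
  digitSumFuel-0 zero    = ≡.refl
  digitSumFuel-0 (suc f) = ≡.cong₂ _+_ (m<n⇒m%n≡m 0<p) (≡.trans (≡.cong (digitSumFuel p f) (0/n≡0 p)) (digitSumFuel-0 f))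

  digitSumFuel-irrelevant : ∀ f g n → n ≤ f → n ≤ g → digitSumFuel p f n ≡ digitSumFuel p g n
  digitSumFuel-irrelevant zero    g       _ z≤n _   = ≡.sym (digitSumFuel-0 g)
  digitSumFuel-irrelevant (suc f) zero    _ _   z≤n = digitSumFuel-0 (suc f)
  digitSumFuel-irrelevant (suc f) (suc g) n n≤f n≤g =
    ≡.cong (n % p +_) (digitSumFuel-irrelevant f g (n / p) (/p≤ n f n≤f) (/p≤ n g n≤g))

  digitSum-unfold : ∀ n → digitSum p n ≡ n % p + digitSum p (n / p)
  digitSum-unfold zero    = ≡.sym (≡.cong₂ _+_ (m<n⇒m%n≡m 0<p) (≡.cong (digitSum p) (0/n≡0 p)))
  digitSum-unfold (suc n) = ≡.cong (suc n % p +_)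
    (digitSumFuel-irrelevant n (suc n / p) (suc n / p) (/p≤ (suc n) n ℕ.≤-refl) ℕ.≤-refl)

  digitSum-< : ∀ {q} → q < p → digitSum p q ≡ q
  digitSum-< {q} q<p = begin
    digitSum p q                 ≡⟨ digitSum-unfold q ⟩
    q % p + digitSum p (q / p)   ≡⟨ ≡.cong₂ _+_ (m<n⇒m%n≡m q<p) (≡.cong (digitSum p) (m<n⇒m/n≡0 q<p)) ⟩
    q + 0                        ≡⟨ ℕ.+-identityʳ q ⟩
    q                            ∎
    where open ≡.≡-Reasoning

  private
    m*[p*P]≡m*P*p : ∀ m P → m * (p * P) ≡ m * P * p
    m*[p*P]≡m*P*p m P = ≡.trans (≡.cong (m *_) (ℕ.*-comm p P)) (≡.sym (ℕ.*-assoc m P p))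

    [r+m*[p*P]]%p≡r%p : ∀ r m P → (r + m * (p * P)) % p ≡ r % p
    [r+m*[p*P]]%p≡r%p r m P = ≡.trans (≡.cong (λ x → (r + x) % p) (m*[p*P]≡m*P*p m P)) ([m+kn]%n≡m%n r (m * P) p)

    [r+m*[p*P]]/p≡r/p+m*P : ∀ r m P → (r + m * (p * P)) / p ≡ r / p + m * P
    [r+m*[p*P]]/p≡r/p+m*P r m P = begin
      (r + m * (p * P)) / p      ≡⟨ ≡.cong (λ x → (r + x) / p) (m*[p*P]≡m*P*p m P) ⟩
      (r + m * P * p) / p        ≡⟨ +-distrib-/-∣ʳ r (divides-refl (m * P)) ⟩
      r / p + m * P * p / p      ≡⟨ ≡.cong (r / p +_) (m*n/n≡m (m * P) p) ⟩
      r / p + m * P              ∎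
      where open ≡.≡-Reasoning

    r<p*P⇒r/p<P : ∀ r P → r < p * P → r / p < P
    r<p*P⇒r/p<P r P r< = m<n*o⇒m/o<n (≡.subst (r <_) (ℕ.*-comm p P) r<)

  digitSum-append : ∀ N r m → r < p ^ N → digitSum p (r + m * p ^ N) ≡ digitSum p m + digitSum p r
  digitSum-append zero    zero    m _ = ≡.sym (≡.trans (ℕ.+-identityʳ _) (≡.cong (digitSum p) (≡.sym (ℕ.*-identityʳ m))))
  digitSum-append zero    (suc r) m (s≤s ())
  digitSum-append (suc N) r    m r< = begin
    digitSum p (r + m * p ^ suc N)
      ≡⟨ digitSum-unfold _ ⟩
    (r + m * p ^ suc N) % p + digitSum p ((r + m * p ^ suc N) / p)
      ≡⟨ ≡.cong₂ _+_ ([r+m*[p*P]]%p≡r%p r m (p ^ N)) (≡.cong (digitSum p) ([r+m*[p*P]]/p≡r/p+m*P r m (p ^ N))) ⟩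
    r % p + digitSum p (r / p + m * p ^ N)
      ≡⟨ ≡.cong (r % p +_) (digitSum-append N (r / p) m (r<p*P⇒r/p<P r (p ^ N) r<)) ⟩
    r % p + (digitSum p m + digitSum p (r / p))
      ≡⟨ x∙yz≈y∙xz (r % p) (digitSum p m) (digitSum p (r / p)) ⟩
    digitSum p m + (r % p + digitSum p (r / p))
      ≡⟨ ≡.cong (digitSum p m +_) (≡.sym (digitSum-unfold r)) ⟩
    digitSum p m + digitSum p r
      ∎
    where open ≡.≡-Reasoning

  digit-append-low : ∀ N r m i → r < p ^ N → i < N → digit p i (r + m * p ^ N) ≡ digit p i r
  digit-append-low (suc N) r m zero    _  _         = [r+m*[p*P]]%p≡r%p r m (p ^ N)
  digit-append-low (suc N) r m (suc i) r< (s≤s i<N) =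
    ≡.trans (≡.cong (digit p i) ([r+m*[p*P]]/p≡r/p+m*P r m (p ^ N)))
          (digit-append-low N (r / p) m i (r<p*P⇒r/p<P r (p ^ N) r<) i<N)

  digit-append-high : ∀ N r m → r < p ^ N → digit p N (r + m * p ^ N) ≡ m % p
  digit-append-high zero    zero    m _  = ≡.cong (_% p) (ℕ.*-identityʳ m)
  digit-append-high zero    (suc r) m (s≤s ())
  digit-append-high (suc N) r    m r< =
    ≡.trans (≡.cong (digit p N) ([r+m*[p*P]]/p≡r/p+m*P r m (p ^ N)))
          (digit-append-high N (r / p) m (r<p*P⇒r/p<P r (p ^ N) r<))

module Series {c ℓ : Level} (R : CommutativeRing c ℓ) where
  open CommutativeRing R renaming (_+_ to _+ᴿ_; _*_ to _*ᴿ_; _-_ to _-ᴿ_)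
  open Poly R
  open import Relation.Binary.Reasoning.Setoid setoid
  open import Algebra.Properties.CommutativeSemigroup +-commutativeSemigroup using (interchange)
  open import Algebra.Properties.Ring ring using (x[y-z]≈xy-xz)
  open import Tactic.RingSolver.NonReflective (fromCommutativeRing R (λ _ → nothing)) using (solve; _⊕_; ⊝_; _⊜_)

  sumBelow-cong : ∀ {f g : ℕ → Carrier} M → (∀ i → i < M → f i ≈ g i) → sumBelow f M ≈ sumBelow g M
  sumBelow-cong zero    f≈g = refl
  sumBelow-cong (suc M) f≈g = +-cong (sumBelow-cong M (λ i i<M → f≈g i (ℕ.m<n⇒m<1+n i<M))) (f≈g M ℕ.≤-refl)

  sumBelow-zero : ∀ {f : ℕ → Carrier} M → (∀ i → i < M → f i ≈ 0#) → sumBelow f M ≈ 0#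
  sumBelow-zero zero    f≈0 = refl
  sumBelow-zero (suc M) f≈0 =
    trans (+-cong (sumBelow-zero M (λ i i<M → f≈0 i (ℕ.m<n⇒m<1+n i<M))) (f≈0 M ℕ.≤-refl)) (+-identityʳ 0#)

  sumBelow-single : ∀ {f : ℕ → Carrier} {t} M → t < M → (∀ i → i < M → i ≢ t → f i ≈ 0#) → sumBelow f M ≈ f t
  sumBelow-single {t = t} (suc M) t<1+M f≈0 with t ≟ M
  ... | yes ≡.refl =
    trans (+-congʳ (sumBelow-zero M (λ i i<M → f≈0 i (ℕ.m<n⇒m<1+n i<M) (ℕ.<⇒≢ i<M)))) (+-identityˡ _)
  ... | no t≢M =
    trans (+-cong (sumBelow-single M (ℕ.≤∧≢⇒< (ℕ.≤-pred t<1+M) t≢M) (λ i i<M → f≈0 i (ℕ.m<n⇒m<1+n i<M)))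
                  (f≈0 M ℕ.≤-refl (t≢M ∘ ≡.sym)))
          (+-identityʳ _)

  sumBelow-suc : ∀ (f : ℕ → Carrier) M → sumBelow f (suc M) ≈ f 0 +ᴿ sumBelow (f ∘ suc) M
  sumBelow-suc f zero    = trans (+-identityˡ _) (sym (+-identityʳ _))
  sumBelow-suc f (suc M) = trans (+-congʳ (sumBelow-suc f M)) (+-assoc _ _ _)

  sumBelow-add : ∀ (f g : ℕ → Carrier) M → sumBelow (λ i → f i +ᴿ g i) M ≈ sumBelow f M +ᴿ sumBelow g M
  sumBelow-add f g zero    = sym (+-identityʳ 0#)
  sumBelow-add f g (suc M) = trans (+-congʳ (sumBelow-add f g M)) (interchange _ _ _ _)

  sumBelow-sub : ∀ (f g : ℕ → Carrier) M → sumBelow (λ i → f i -ᴿ g i) M ≈ sumBelow f M -ᴿ sumBelow g M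
  sumBelow-sub f g zero    = sym (-‿inverseʳ 0#)
  sumBelow-sub f g (suc M) = trans (+-congʳ (sumBelow-sub f g M))
    (solve 4 (λ a b x y → ((a ⊕ (⊝ b)) ⊕ (x ⊕ (⊝ y))) ⊜ ((a ⊕ x) ⊕ (⊝ (b ⊕ y)))) refl _ _ _ _)

  sumBelow-swap : ∀ (h : ℕ → ℕ → Carrier) I K →
    sumBelow (λ i → sumBelow (h i) K) I ≈ sumBelow (λ k → sumBelow (λ i → h i k) I) K
  sumBelow-swap h I zero    = sumBelow-zero I (λ _ _ → refl)
  sumBelow-swap h I (suc K) = trans (sumBelow-add (λ i → sumBelow (h i) K) (λ i → h i K) I)
                                    (+-congʳ (sumBelow-swap h I K))

  sumFin-cong : ∀ {n} {f g : Fin n → Carrier} → (∀ i → f i ≈ g i) → sumFin f ≈ sumFin g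
  sumFin-cong {zero}  f≈g = refl
  sumFin-cong {suc n} f≈g = +-cong (f≈g Fin.zero) (sumFin-cong (f≈g ∘ Fin.suc))

  sumFin≈sumBelow : ∀ {n} (f : ℕ → Carrier) → sumFin {n} (f ∘ toℕ) ≈ sumBelow f n
  sumFin≈sumBelow {zero}  f = refl
  sumFin≈sumBelow {suc n} f = trans (+-congˡ (sumFin≈sumBelow {n} (f ∘ suc))) (sym (sumBelow-suc f n))

  windowSum-periodic : ∀ {a : ℕ → Carrier} n → (∀ j → a (n + j) ≈ a j) →
                       ∀ j → sumBelow (λ i → a (i + j)) n ≈ sumBelow a n
  windowSum-periodic         zero    _        _       = refl
  windowSum-periodic {a = a} (suc m) periodic zero    =
    sumBelow-cong (suc m) (λ i _ → reflexive (≡.cong a (ℕ.+-identityʳ i)))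
  windowSum-periodic {a = a} (suc m) periodic (suc j) = begin
    sumBelow (λ i → a (i + suc j)) m +ᴿ a (m + suc j)  ≈⟨ +-cong (sumBelow-cong m (λ i _ → reflexive (≡.cong a (ℕ.+-suc i j))))
                                                                  (trans (reflexive (≡.cong a (ℕ.+-suc m j))) (periodic j)) ⟩
    sumBelow (λ i → a (suc i + j)) m +ᴿ a j            ≈⟨ +-comm _ _ ⟩
    a j +ᴿ sumBelow (λ i → a (suc i + j)) m            ≈⟨ sumBelow-suc (λ i → a (i + j)) m ⟨
    sumBelow (λ i → a (i + j)) (suc m)                 ≈⟨ windowSum-periodic (suc m) periodic j ⟩
    sumBelow a (suc m)                                 ∎

  infix  4 _≋_
  infixl 6 _⊞_ _⊟_

  _≋_ : Ser → Ser → Set ℓ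
  f ≋ g = ∀ n → f n ≈ g n

  _⊞_ _⊟_ : Ser → Ser → Ser
  (f ⊞ g) n = f n +ᴿ g n
  (f ⊟ g) n = f n -ᴿ g n

  sumSeries : (ℕ → Ser) → ℕ → Ser
  sumSeries C M n = sumBelow (λ q → C q n) M

  -- shift k f, diff k f and diffs p N f are f x^k, f (1 - x^k) and f ∏_{m<N} (1 - x^{p^m}).
  shift : ℕ → Ser → Ser
  shift zero    f n       = f n
  shift (suc k) f zero    = 0#
  shift (suc k) f (suc n) = shift k f n

  diff : ℕ → Ser → Ser
  diff k f = f ⊟ shift k f

  diffs : ℕ → ℕ → Ser → Ser
  diffs p zero    f = f
  diffs p (suc N) f = diff (p ^ N) (diffs p N f)

  shift-+ : ∀ k (f : Ser) n → shift k f (k + n) ≡ f n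
  shift-+ zero    f n = ≡.refl
  shift-+ (suc k) f n = shift-+ k f n

  shift-shift : ∀ j k (f : Ser) n → shift j (shift k f) n ≡ shift (j + k) f n
  shift-shift zero    k f n       = ≡.refl
  shift-shift (suc j) k f zero    = ≡.refl
  shift-shift (suc j) k f (suc n) = shift-shift j k f n

  shift-comm : ∀ j k (f : Ser) n → shift j (shift k f) n ≡ shift k (shift j f) n
  shift-comm j k f n = ≡.trans (shift-shift j k f n)
    (≡.trans (≡.cong (λ i → shift i f n) (ℕ.+-comm j k)) (≡.sym (shift-shift k j f n)))

  shift-vanishes : ∀ k {f : Ser} (Z : ℕ → Set) → (∀ m → Z (k + m) → f m ≈ 0#) → ∀ n → Z n → shift k f n ≈ 0#
  shift-vanishes zero    Z f≈0 n       z = f≈0 n z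
  shift-vanishes (suc k) Z f≈0 zero    z = refl
  shift-vanishes (suc k) Z f≈0 (suc n) z = shift-vanishes k (Z ∘ suc) f≈0 n z

  shift-cong : ∀ k {f g : Ser} → f ≋ g → shift k f ≋ shift k g
  shift-cong zero    f≈g n       = f≈g n
  shift-cong (suc k) f≈g zero    = refl
  shift-cong (suc k) f≈g (suc n) = shift-cong k f≈g n

  shift-⊞ : ∀ k (f g : Ser) → shift k (f ⊞ g) ≋ shift k f ⊞ shift k g
  shift-⊞ zero    f g n       = refl
  shift-⊞ (suc k) f g zero    = sym (+-identityʳ 0#)
  shift-⊞ (suc k) f g (suc n) = shift-⊞ k f g n

  shift-⊟ : ∀ k (f g : Ser) → shift k (f ⊟ g) ≋ shift k f ⊟ shift k g
  shift-⊟ zero    f g n       = refl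
  shift-⊟ (suc k) f g zero    = sym (-‿inverseʳ 0#)
  shift-⊟ (suc k) f g (suc n) = shift-⊟ k f g n

  shift-sumSeries : ∀ k (C : ℕ → Ser) M → shift k (sumSeries C M) ≋ sumSeries (λ q → shift k (C q)) M
  shift-sumSeries zero    C M n       = refl
  shift-sumSeries (suc k) C M zero    = sym (sumBelow-zero M (λ _ _ → refl))
  shift-sumSeries (suc k) C M (suc n) = shift-sumSeries k C M n

  diff-cong : ∀ k {f g : Ser} → f ≋ g → diff k f ≋ diff k g
  diff-cong k f≈g n = +-cong (f≈g n) (-‿cong (shift-cong k f≈g n))

  diff-shift : ∀ j k (f : Ser) → diff j (shift k f) ≋ shift k (diff j f)
  diff-shift j k f n = trans (+-congˡ (-‿cong (reflexive (shift-comm j k f n)))) (sym (shift-⊟ k f (shift j f) n))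

  diff-sumSeries : ∀ k (C : ℕ → Ser) M → diff k (sumSeries C M) ≋ sumSeries (λ q → diff k (C q)) M
  diff-sumSeries k C M n = trans (+-congˡ (-‿cong (shift-sumSeries k C M n)))
                                 (sym (sumBelow-sub (λ q → C q n) (λ q → shift k (C q) n) M))

  diffs-shift : ∀ p N k (f : Ser) → diffs p N (shift k f) ≋ shift k (diffs p N f)
  diffs-shift p zero    k f n = refl
  diffs-shift p (suc N) k f n =
    trans (diff-cong (p ^ N) (diffs-shift p N k f) n) (diff-shift (p ^ N) k (diffs p N f) n)

  diffs-sumSeries : ∀ p N (C : ℕ → Ser) M → diffs p N (sumSeries C M) ≋ sumSeries (λ q → diffs p N (C q)) M
  diffs-sumSeries p zero    C M n = refl
  diffs-sumSeries p (suc N) C M n =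
    trans (diff-cong (p ^ N) (diffs-sumSeries p N C M) n) (diff-sumSeries (p ^ N) (λ q → diffs p N (C q)) M n)

  summation-by-parts : ∀ P (C : ℕ → Ser) M →
    sumSeries (λ q → diff P (shift (q * P) (sumSeries C (suc q)))) M ⊞ shift (M * P) (sumSeries C (suc M))
      ≋ sumSeries (λ q → shift (q * P) (C q)) (suc M)
  summation-by-parts P C zero    n = +-identityˡ _
  summation-by-parts P C (suc M) n = begin
    (s +ᴿ (x -ᴿ shift P (shift (M * P) S) n)) +ᴿ shift (suc M * P) (S ⊞ C (suc M)) n
        ≈⟨ +-cong (+-congˡ (+-congˡ (-‿cong (reflexive (shift-shift P (M * P) S n))))) (shift-⊞ (suc M * P) S (C (suc M)) n) ⟩
    (s +ᴿ (x -ᴿ y)) +ᴿ (y +ᴿ z)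
        -- the solver runs without a zero test on coefficients, so it cannot cancel y - y itself
        ≈⟨ solve 5 (λ s x y y⁻ z → ((s ⊕ (x ⊕ y⁻)) ⊕ (y ⊕ z)) ⊜ ((s ⊕ x) ⊕ ((y ⊕ y⁻) ⊕ z))) refl s x y (- y) z ⟩
    (s +ᴿ x) +ᴿ ((y -ᴿ y) +ᴿ z)   ≈⟨ +-congˡ (trans (+-congʳ (-‿inverseʳ y)) (+-identityˡ z)) ⟩
    (s +ᴿ x) +ᴿ z                 ≈⟨ +-congʳ (summation-by-parts P C M n) ⟩
    sumSeries (λ q → shift (q * P) (C q)) (suc M) n +ᴿ z ∎
    where
    S : Ser
    S = sumSeries C (suc M)
    s x y z : Carrier
    s = sumSeries (λ q → diff P (shift (q * P) (sumSeries C (suc q)))) M n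
    x = shift (M * P) S n
    y = shift (suc M * P) S n
    z = shift (suc M * P) (C (suc M)) n

  mono-≡ : ∀ k → mono k k ≡ 1#
  mono-≡ k with k ≟ k
  ... | yes _   = ≡.refl
  ... | no k≢k = contradiction ≡.refl k≢k

  mono-≢ : ∀ k {n} → n ≢ k → mono k n ≡ 0#
  mono-≢ k {n} n≢k with n ≟ k
  ... | yes n≡k = contradiction n≡k n≢k
  ... | no _    = ≡.refl

  mono≋shift : ∀ k → mono k ≋ shift k (mono 0)
  mono≋shift zero    n       = refl
  mono≋shift (suc k) zero    = refl
  mono≋shift (suc k) (suc n) with n ≟ k
  ... | yes ≡.refl = trans (reflexive (mono-≡ (suc n))) (trans (sym (reflexive (mono-≡ n))) (mono≋shift n n))
  ... | no n≢k     = trans (reflexive (mono-≢ (suc k) (n≢k ∘ ℕ.suc-injective)))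
                           (trans (sym (reflexive (mono-≢ k n≢k))) (mono≋shift k n))

  ⊛-congˡ : ∀ (f : Ser) {g h : Ser} → g ≋ h → f ⊛ g ≋ f ⊛ h
  ⊛-congˡ f g≈h n = sumBelow-cong (suc n) (λ i _ → *-congˡ (g≈h (n ∸ i)))

  ⊛-distribˡ-⊟ : ∀ (f g h : Ser) → f ⊛ (g ⊟ h) ≋ (f ⊛ g) ⊟ (f ⊛ h)
  ⊛-distribˡ-⊟ f g h n =
    trans (sumBelow-cong (suc n) (λ i _ → x[y-z]≈xy-xz (f i) (g (n ∸ i)) (h (n ∸ i))))
          (sumBelow-sub (λ i → f i *ᴿ g (n ∸ i)) (λ i → f i *ᴿ h (n ∸ i)) (suc n))

  ⊛-identityʳ : ∀ (f : Ser) → f ⊛ mono 0 ≋ f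
  ⊛-identityʳ f n = begin
    sumBelow (λ i → f i *ᴿ mono 0 (n ∸ i)) n +ᴿ f n *ᴿ mono 0 (n ∸ n)
      ≈⟨ +-cong (sumBelow-zero n (λ i i<n → trans (*-congˡ (reflexive (mono-≢ 0 (ℕ.m>n⇒m∸n≢0 i<n)))) (zeroʳ _)))
                (*-congˡ (reflexive (≡.trans (≡.cong (mono 0) (ℕ.n∸n≡0 n)) (mono-≡ 0)))) ⟩
    0# +ᴿ f n *ᴿ 1#  ≈⟨ trans (+-identityˡ _) (*-identityʳ _) ⟩
    f n              ∎

  ⊛-shift₁ : ∀ (f g : Ser) → f ⊛ shift 1 g ≋ shift 1 (f ⊛ g)
  ⊛-shift₁ f g zero    = trans (+-identityˡ _) (zeroʳ _)
  ⊛-shift₁ f g (suc n) = begin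
    sumBelow (λ i → f i *ᴿ shift 1 g (suc n ∸ i)) (suc n) +ᴿ f (suc n) *ᴿ shift 1 g (n ∸ n)
      ≈⟨ +-cong (sumBelow-cong (suc n) (λ i i≤n → *-congˡ (reflexive (≡.cong (shift 1 g) (ℕ.+-∸-assoc 1 (ℕ.≤-pred i≤n))))))
                (*-congˡ (reflexive (≡.cong (shift 1 g) (ℕ.n∸n≡0 n)))) ⟩
    (f ⊛ g) n +ᴿ f (suc n) *ᴿ 0#  ≈⟨ trans (+-congˡ (zeroʳ _)) (+-identityʳ _) ⟩
    (f ⊛ g) n                     ∎

  ⊛-shift : ∀ k (f g : Ser) → f ⊛ shift k g ≋ shift k (f ⊛ g)
  ⊛-shift zero    f g n = refl
  ⊛-shift (suc k) f g n = begin
    (f ⊛ shift (suc k) g) n       ≈⟨ ⊛-congˡ f (λ m → reflexive (≡.sym (shift-shift 1 k g m))) n ⟩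
    (f ⊛ shift 1 (shift k g)) n   ≈⟨ ⊛-shift₁ f (shift k g) n ⟩
    shift 1 (f ⊛ shift k g) n     ≈⟨ shift-cong 1 (⊛-shift k f g) n ⟩
    shift 1 (shift k (f ⊛ g)) n   ≡⟨ shift-shift 1 k (f ⊛ g) n ⟩
    shift (suc k) (f ⊛ g) n       ∎

  ⊛-mono : ∀ k (f : Ser) → f ⊛ mono k ≋ shift k f
  ⊛-mono k f n = begin
    (f ⊛ mono k) n              ≈⟨ ⊛-congˡ f (mono≋shift k) n ⟩
    (f ⊛ shift k (mono 0)) n    ≈⟨ ⊛-shift k f (mono 0) n ⟩
    shift k (f ⊛ mono 0) n      ≈⟨ shift-cong k (⊛-identityʳ f) n ⟩
    shift k f n                 ∎

  ⊛-oneMinusX^ : ∀ k (f : Ser) → f ⊛ oneMinusX^ k ≋ diff k f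
  ⊛-oneMinusX^ k f n = trans (⊛-distribˡ-⊟ f (mono 0) (mono k) n) (+-cong (⊛-identityʳ f n) (-‿cong (⊛-mono k f n)))

  ⊛-diff : ∀ k (f g : Ser) → f ⊛ diff k g ≋ diff k (f ⊛ g)
  ⊛-diff k f g n = trans (⊛-distribˡ-⊟ f g (shift k g) n) (+-congˡ (-‿cong (⊛-shift k f g n)))

  ⊛-prodFactors : ∀ p N (f : Ser) → f ⊛ prodFactors p N ≋ diffs p N f
  ⊛-prodFactors p zero    f n = ⊛-identityʳ f n
  ⊛-prodFactors p (suc N) f n = begin
    (f ⊛ (prodFactors p N ⊛ oneMinusX^ (p ^ N))) n  ≈⟨ ⊛-congˡ f (⊛-oneMinusX^ (p ^ N) (prodFactors p N)) n ⟩
    (f ⊛ diff (p ^ N) (prodFactors p N)) n          ≈⟨ ⊛-diff (p ^ N) f (prodFactors p N) n ⟩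
    diff (p ^ N) (f ⊛ prodFactors p N) n            ≈⟨ diff-cong (p ^ N) (⊛-prodFactors p N f) n ⟩
    diff (p ^ N) (diffs p N f) n                    ∎

  module _ (P : ℕ) .{{_ : NonZero P}} (G : ℕ → Ser) (G-vanishes : ∀ q m → P ≤ m → G q m ≈ 0#) where

    shiftBlock-off : ∀ {q t r} → r < P → q ≢ t → shift (q * P) (G q) (r + t * P) ≈ 0#
    shiftBlock-off {q} {t} {r} r<P q≢t = shift-vanishes (q * P) (_≡ r + t * P) G-off (r + t * P) ≡.refl
      where
      G-off : ∀ m → q * P + m ≡ r + t * P → G q m ≈ 0#
      G-off m eq with m <? P
      ... | yes m<P = contradiction (≡.trans (≡.sym ([r+q*P]/P≡q q P m<P))
                                      (≡.trans (≡.cong (_/ P) (≡.trans (ℕ.+-comm m (q * P)) eq)) ([r+q*P]/P≡q t P r<P))) q≢t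
      ... | no  m≮P = G-vanishes q m (ℕ.≮⇒≥ m≮P)

    blockSum-hit : ∀ M {t r} → r < P → t < M → sumSeries (λ q → shift (q * P) (G q)) M (r + t * P) ≈ G t r
    blockSum-hit M {t} {r} r<P t<M =
      trans (sumBelow-single M t<M (λ q _ q≢t → shiftBlock-off r<P q≢t))
            (reflexive (≡.trans (≡.cong (shift (t * P) (G t)) (ℕ.+-comm r (t * P))) (shift-+ (t * P) (G t) r)))

    blockSum-miss : ∀ M {t r} → r < P → M ≤ t → sumSeries (λ q → shift (q * P) (G q)) M (r + t * P) ≈ 0#
    blockSum-miss M r<P M≤t = sumBelow-zero M (λ q q<M → shiftBlock-off r<P (ℕ.<⇒≢ (ℕ.<-≤-trans q<M M≤t)))

module ThueMorse {c ℓ : Level} (R : CommutativeRing c ℓ) (p-2 : ℕ) where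
  open CommutativeRing R renaming (_+_ to _+ᴿ_; _*_ to _*ᴿ_; _-_ to _-ᴿ_)
  open Poly R
  open Series R
  open import Relation.Binary.Reasoning.Setoid setoid

  p : ℕ
  p = suc (suc p-2)

  open Digits p (s≤s (s≤s z≤n))

  -- Unlike F_N, the coefficient is looked up at the digit sum itself rather than at its residue mod p,
  -- so that the top digit splits off additively (digitSum-append).
  digitSeries : ℕ → (ℕ → Carrier) → Ser
  digitSeries N a n with n <? p ^ N
  ... | yes _ = a (digitSum p n)
  ... | no  _ = 0#

  digitSeries-< : ∀ N a {n} → n < p ^ N → digitSeries N a n ≡ a (digitSum p n)
  digitSeries-< N a {n} n< with n <? p ^ N
  ... | yes _ = ≡.refl
  ... | no n≮ = contradiction n< n≮

  digitSeries-≮ : ∀ N a {n} → ¬ n < p ^ N → digitSeries N a n ≡ 0#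
  digitSeries-≮ N a {n} n≮ with n <? p ^ N
  ... | yes n< = contradiction n< n≮
  ... | no _   = ≡.refl

  digitSeries-vanishes : ∀ N {a} → (∀ j → a j ≈ 0#) → ∀ n → digitSeries N a n ≈ 0#
  digitSeries-vanishes N a≈0 n with n <? p ^ N
  ... | yes _ = a≈0 (digitSum p n)
  ... | no  _ = refl

  digitSeries-sumBelow : ∀ N (b : ℕ → ℕ → Carrier) M →
    digitSeries N (λ j → sumBelow (λ k → b k j) M) ≋ sumSeries (λ k → digitSeries N (b k)) M
  digitSeries-sumBelow N b M n with n <? p ^ N
  ... | yes _ = refl
  ... | no  _ = sym (sumBelow-zero M (λ _ _ → refl))

  digitSeries-suc : ∀ N a → digitSeries (suc N) a ≋ sumSeries (λ q → shift (q * p ^ N) (digitSeries N (λ j → a (q + j)))) p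
  digitSeries-suc N a n = ≡.subst (λ m → digitSeries (suc N) a m ≈ blocks m) (≡.sym (m≡m%n+[m/n]*n n P))
                                  (at (n % P) (n / P) (m%n<n n P))
    where
    P : ℕ
    P = p ^ N
    instance
      P≢0 : NonZero P
      P≢0 = ℕ.m^n≢0 p N
    C : ℕ → Ser
    C q = digitSeries N (λ j → a (q + j))
    blocks : Ser
    blocks = sumSeries (λ q → shift (q * P) (C q)) p
    C-vanishes : ∀ q m → P ≤ m → C q m ≈ 0#
    C-vanishes q m P≤m = reflexive (digitSeries-≮ N _ (ℕ.≤⇒≯ P≤m))
    at : ∀ r t → r < P → digitSeries (suc N) a (r + t * P) ≈ blocks (r + t * P)
    at r t r<P with t <? p
    ... | yes t<p = begin
      digitSeries (suc N) a (r + t * P)  ≡⟨ digitSeries-< (suc N) a (r+q*P<Q*P r<P t<p) ⟩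
      a (digitSum p (r + t * P))         ≡⟨ ≡.cong a (digitSum-append N r t r<P) ⟩
      a (digitSum p t + digitSum p r)    ≡⟨ ≡.cong (λ d → a (d + digitSum p r)) (digitSum-< t<p) ⟩
      a (t + digitSum p r)               ≡⟨ digitSeries-< N (λ j → a (t + j)) r<P ⟨
      C t r                              ≈⟨ blockSum-hit P C C-vanishes p r<P t<p ⟨
      blocks (r + t * P)                 ∎
    ... | no t≮p = trans (reflexive (digitSeries-≮ (suc N) a (ℕ.≤⇒≯ p*P≤r+t*P)))
                         (sym (blockSum-miss P C C-vanishes p r<P (ℕ.≮⇒≥ t≮p)))
      where
      p*P≤r+t*P : p * P ≤ r + t * P
      p*P≤r+t*P = ℕ.≤-trans (ℕ.*-monoˡ-≤ P (ℕ.≮⇒≥ t≮p)) (ℕ.m≤n+m (t * P) r)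

  WindowSumsVanish : (ℕ → Carrier) → Set ℓ
  WindowSumsVanish a = ∀ j → sumBelow (λ i → a (i + j)) p ≈ 0#

  cumulative : (ℕ → Carrier) → ℕ → ℕ → Carrier
  cumulative a q j = sumBelow (λ k → a (k + j)) (suc q)

  cumulative-windowSumsVanish : ∀ a → WindowSumsVanish a → ∀ q → WindowSumsVanish (cumulative a q)
  cumulative-windowSumsVanish a vanish q j = begin
    sumBelow (λ i → sumBelow (λ k → a (k + (i + j))) (suc q)) p  ≈⟨ sumBelow-swap (λ i k → a (k + (i + j))) p (suc q) ⟩
    sumBelow (λ k → sumBelow (λ i → a (k + (i + j))) p) (suc q)
      ≈⟨ sumBelow-cong (suc q) (λ k _ → sumBelow-cong p (λ i _ → reflexive (≡.cong a (x∙yz≈y∙xz k i j)))) ⟩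
    sumBelow (λ k → sumBelow (λ i → a (i + (k + j))) p) (suc q)  ≈⟨ sumBelow-zero (suc q) (λ k _ → vanish (k + j)) ⟩
    0#                                                           ∎

  InI-append : ∀ N {r q} → q < p ∸ 1 → InI p N r → InI p (suc N) (r + q * p ^ N)
  InI-append N {r} {q} q<p-1 (r< , r-digits) = r+q*P<Q*P r< (ℕ.m<n⇒m<1+n q<p-1) , digits
    where
    digits : ∀ i → i < suc N → digit p i (r + q * p ^ N) < p ∸ 1
    digits i i≤N with i ≟ N
    ... | yes ≡.refl =
      ≡.subst (_< p ∸ 1) (≡.sym (≡.trans (digit-append-high N r q r<) (m<n⇒m%n≡m (ℕ.m<n⇒m<1+n q<p-1)))) q<p-1
    ... | no  i≢N    = let i<N = ℕ.≤∧≢⇒< (ℕ.≤-pred i≤N) i≢N in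
                       ≡.subst (_< p ∸ 1) (≡.sym (digit-append-low N r q i r< i<N)) (r-digits i i<N)

  SupportedIn : ℕ → Ser → Set ℓ
  SupportedIn N cs = ∀ j → ¬ InI p N j → cs j ≈ 0#

  blocksOf : ℕ → (ℕ → Ser) → Ser
  blocksOf N cs = sumSeries (λ q → shift (q * p ^ N) (cs q)) (p ∸ 1)

  blocksOf-supportedIn : ∀ N cs → (∀ q → SupportedIn N (cs q)) → SupportedIn (suc N) (blocksOf N cs)
  blocksOf-supportedIn N cs supported j j∉I = sumBelow-zero (p ∸ 1) block-vanishes
    where
    block-vanishes : ∀ q → q < p ∸ 1 → shift (q * p ^ N) (cs q) j ≈ 0#
    block-vanishes q q<p-1 = shift-vanishes (q * p ^ N) (¬_ ∘ InI p (suc N))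
      (λ m m∉I → supported q m (λ m∈I → m∉I (≡.subst (InI p (suc N)) (ℕ.+-comm m (q * p ^ N)) (InI-append N q<p-1 m∈I))))
      j j∉I

  blocksOf-expansion : ∀ N a (cs : ℕ → Ser) → WindowSumsVanish a →
    (∀ q → digitSeries N (cumulative a q) ≋ diffs p N (cs q)) → digitSeries (suc N) a ≋ diffs p (suc N) (blocksOf N cs)
  blocksOf-expansion N a cs vanish expansions n = sym $ begin
    diff P (diffs p N (blocksOf N cs)) n                                 ≈⟨ diff-cong P inner n ⟩
    diff P (sumSeries (λ q → shift (q * P) (S (suc q))) (p ∸ 1)) n       ≈⟨ diff-sumSeries P _ (p ∸ 1) n ⟩
    sumSeries (λ q → diff P (shift (q * P) (S (suc q)))) (p ∸ 1) n       ≈⟨ +-identityʳ _ ⟨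
    sumSeries (λ q → diff P (shift (q * P) (S (suc q)))) (p ∸ 1) n +ᴿ 0#
      ≈⟨ +-congˡ (shift-vanishes ((p ∸ 1) * P) (λ _ → ⊤) (λ m _ → S-p≋0 m) n _) ⟨
    sumSeries (λ q → diff P (shift (q * P) (S (suc q)))) (p ∸ 1) n +ᴿ shift ((p ∸ 1) * P) (S p) n
      ≈⟨ summation-by-parts P C (p ∸ 1) n ⟩
    sumSeries (λ q → shift (q * P) (C q)) p n                            ≈⟨ digitSeries-suc N a n ⟨
    digitSeries (suc N) a n                                              ∎
    where
    P : ℕ
    P = p ^ N
    C : ℕ → Ser
    C q = digitSeries N (λ j → a (q + j))
    S : ℕ → Ser
    S = sumSeries C
    S≋cumulative : ∀ q → S (suc q) ≋ digitSeries N (cumulative a q)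
    S≋cumulative q m = sym (digitSeries-sumBelow N (λ k j → a (k + j)) (suc q) m)
    S-p≋0 : ∀ m → S p m ≈ 0#
    S-p≋0 m = trans (sym (digitSeries-sumBelow N (λ k j → a (k + j)) p m)) (digitSeries-vanishes N vanish m)
    inner : diffs p N (blocksOf N cs) ≋ sumSeries (λ q → shift (q * P) (S (suc q))) (p ∸ 1)
    inner m = trans (diffs-sumSeries p N (λ q → shift (q * P) (cs q)) (p ∸ 1) m)
      (sumBelow-cong (p ∸ 1) (λ q _ → trans (diffs-shift p N (q * P) (cs q) m)
                                            (shift-cong (q * P) (λ m′ → sym (trans (S≋cumulative q m′) (expansions q m′))) m)))

  expansion : ∀ N a → WindowSumsVanish a → Σ Ser (λ cs → SupportedIn N cs × digitSeries N a ≋ diffs p N cs)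
  expansion zero    a _      =
    digitSeries 0 a , (λ j j∉I → reflexive (digitSeries-≮ 0 a (λ j<1 → j∉I (j<1 , λ _ ())))) , (λ _ → refl)
  expansion (suc N) a vanish =
    blocksOf N cs , blocksOf-supportedIn N cs (proj₁ ∘ proj₂ ∘ ih) , blocksOf-expansion N a cs vanish (proj₂ ∘ proj₂ ∘ ih)
    where
    ih : ∀ q → Σ Ser (λ cs → SupportedIn N cs × digitSeries N (cumulative a q) ≋ diffs p N cs)
    ih q = expansion N (cumulative a q) (cumulative-windowSumsVanish a vanish q)
    cs : ℕ → Ser
    cs = proj₁ ∘ ih

  extend : (Fin p → Carrier) → ℕ → Carrier
  extend A j = A (j mod p)

  extend-windowSumsVanish : ∀ A → sumFin A ≈ 0# → WindowSumsVanish (extend A)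
  extend-windowSumsVanish A ΣA≈0 j = begin
    sumBelow (λ i → extend A (i + j)) p  ≈⟨ windowSum-periodic p periodic j ⟩
    sumBelow (extend A) p                ≈⟨ sumFin≈sumBelow {p} (extend A) ⟨
    sumFin {p} (extend A ∘ toℕ)          ≈⟨ sumFin-cong extend-toℕ ⟩
    sumFin A                             ≈⟨ ΣA≈0 ⟩
    0#                                   ∎
    where
    periodic : ∀ j → extend A (p + j) ≈ extend A j
    periodic j = reflexive (≡.cong A (Finₚ.fromℕ<-cong _ _ (≡.trans (≡.cong (_% p) (ℕ.+-comm p j)) ([m+n]%n≡m%n j p)) _ _))
    extend-toℕ : ∀ i → extend A (toℕ i) ≈ A i
    extend-toℕ i = reflexive (≡.cong A (≡.trans (Finₚ.fromℕ<-cong _ _ (m<n⇒m%n≡m (Finₚ.toℕ<n i)) _ (Finₚ.toℕ<n i))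
                                          (Finₚ.fromℕ<-toℕ i _)))

  F_N≋digitSeries : ∀ A N → F_N p A N ≋ digitSeries N (extend A)
  F_N≋digitSeries A N n with n <? p ^ N
  ... | yes _ = refl
  ... | no  _ = refl

mainTheorem2 : ∀ {c ℓ : Level} (R : CommutativeRing c ℓ) →
    let open CommutativeRing R in
    let open Poly R in
    (p : ℕ) .{{_ : NonZero p}} → 2 ≤ p →
    (A : Fin p → Carrier) → sumFin A ≈ 0# →
    (N : ℕ) → 1 ≤ N →
    Σ (ℕ → Carrier) (λ cs →
      (∀ j → ¬ InI p N j → cs j ≈ 0#) ×
      (∀ n → F_N p A N n ≈ (cs ⊛ prodFactors p N) n))
-- The expansion holds for N = 0 as well.
mainTheorem2 R (suc (suc p-2)) (s≤s (s≤s z≤n)) A ΣA≈0 N _ =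
  let cs , supported , digitSeries≋diffs = expansion N (extend A) (extend-windowSumsVanish A ΣA≈0) in
  cs , supported , λ n → trans (F_N≋digitSeries A N n) (trans (digitSeries≋diffs n) (sym (⊛-prodFactors p N cs n)))
  where
  open CommutativeRing R using (trans; sym)
  open Series R using (⊛-prodFactors)
  open ThueMorse R p-2 using (p; expansion; extend; extend-windowSumsVanish; F_N≋digitSeries)
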